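{- Let $q\in\{2,3\}$. There is an absolute constant $D>0$ such that the following holds for every finite $q$-group $G$. Let $f:\{0,1\}^n\to G$ be any function and let $\{P_1,\dots,P_t\}$ be the set of all polynomials in $\mathcal{P}_1(\{0,1\}^n,G)$ with $\delta(f,P_i)\le1/2$. Writing $\delta(f,P_i)=\frac12-\alpha_i$ for each $i\in[t]$, we have $\sum_{i=1}^t\alpha_i^D\le1$. In particular, the number of $i$ with $\delta(f,P_i)\le\frac12-\varepsilon$ is at most $(1/\varepsilon)^D$.
   Context: A $q$-group is a finite Abelian group in which every element has order a power of $q$. $\mathcal{P}_1(\{0,1\}^n,G)$ is the set of functions $P(x)=a_0+\sum_{i=1}^n a_ix_i$, $a_i\in G$, $x\in\{0,1\}^n$. $\delta(f,P)=\Pr_{x\sim\{0,1\}^n}[f(x)\ne P(x)]$. -}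

module Defs where

open import Level using (0ℓ)
open import Algebra.Bundles using (AbelianGroup)
open import Data.Bool using (Bool; true; false; if_then_else_)
open import Data.Nat as ℕ using (ℕ; zero; suc; _<_)
open import Data.Nat.Properties using (m^n≢0)
open import Data.Integer using (+_)
open import Data.Fin using (Fin)
open import Data.Vec using (Vec; []; _∷_)
open import Data.List using (List; []; _∷_; _++_; map; foldr; length; filter)
open import Data.List.Relation.Unary.All using (All)
open import Data.List.Relation.Unary.AllPairs using (AllPairs)
open import Data.Product using (Σ; _×_; ∃)
open import Function.Definitions using (Surjective; Injective)
open import Relation.Binary using (Decidable)
open import Relation.Binary.PropositionalEquality using (_≡_)
open import Relation.Nullary using (¬_; does)
open import Data.Rational as ℚ using (ℚ; 0ℚ; 1ℚ; _/_)

record FiniteAbelianGroup : Set₁ where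
  field
    grp       : AbelianGroup 0ℓ 0ℓ
  open AbelianGroup grp public
  field
    _≟_       : Decidable _≈_
    size      : ℕ
    enum      : Fin size → Carrier
    enum-inj  : Injective _≡_ _≈_ enum
    enum-surj : ∀ g → ∃ λ i → enum i ≈ g

  _·_ : ℕ → Carrier → Carrier
  zero  · g = ε
  suc m · g = g ∙ (m · g)

  HasOrder : Carrier → ℕ → Set
  HasOrder g k = (0 < k) × (k · g ≈ ε) × (∀ m → 0 < m → m < k → ¬ (m · g ≈ ε))

open FiniteAbelianGroup public using () renaming (Carrier to ∣_∣)

IsQGroup : ℕ → FiniteAbelianGroup → Set
IsQGroup q G = ∀ g → ∃ λ k → HasOrder g (q ℕ.^ k)
  where open FiniteAbelianGroup G

-- The Boolean cube {0,1}^n, as Vec Bool n (true = 1).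

cube : (n : ℕ) → List (Vec Bool n)
cube zero    = [] ∷ []
cube (suc n) = map (false ∷_) (cube n) ++ map (true ∷_) (cube n)

record Poly₁ (G : FiniteAbelianGroup) (n : ℕ) : Set where
  constructor poly
  field
    a₀ : ∣ G ∣
    as : Vec ∣ G ∣ n

module _ (G : FiniteAbelianGroup) where
  open FiniteAbelianGroup G

  linSum : ∀ {n} → Vec Carrier n → Vec Bool n → Carrier
  linSum []       []       = ε
  linSum (a ∷ as) (x ∷ xs) = (if x then a else ε) ∙ linSum as xs

  evalP : ∀ {n} → Poly₁ G n → Vec Bool n → Carrier
  evalP (poly a₀ as) x = a₀ ∙ linSum as x

  disagree : ∀ {n} → (Vec Bool n → Carrier) → (Vec Bool n → Carrier) → ℕ
  disagree {n} f g = length (filter (λ x → Relation.Nullary.¬? (f x ≟ g x)) (cube n))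

  δ : ∀ {n} → (Vec Bool n → Carrier) → (Vec Bool n → Carrier) → ℚ
  δ {n} f g = _/_ (+ disagree f g) (2 ℕ.^ n) {{m^n≢0 2 n}}

  SameFun : ∀ {n} → Poly₁ G n → Poly₁ G n → Set
  SameFun P Q = ∀ x → evalP P x ≈ evalP Q x

_^ℚ_ : ℚ → ℕ → ℚ
p ^ℚ zero  = 1ℚ
p ^ℚ suc k = p ℚ.* (p ^ℚ k)

sumℚ : List ℚ → ℚ
sumℚ = foldr ℚ._+_ 0ℚ

½ : ℚ
½ = + 1 / 2

-- Write N = 2ⁿ and bias(P) = 2·#{x : f x = P x} ∸ N, which is 2N(½ − δ(f,P)) whenever δ(f,P) ≤ ½.
-- We show Σ bias(P)² ≤ N² over pairwise distinct P, so D = 2 works (with Σ αᵢ² ≤ ¼) for every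
-- finite Abelian group. Restricted to x₁ = 0 and x₁ = 1, the polynomial P = b + (c − b) x₁ + ⟨a, x′⟩
-- becomes b + ⟨a, x′⟩ and c + ⟨a, x′⟩; with u_b, v_c their agreement counts with the two halves of f,
-- bias(P) = 2(u_b + v_c) ∸ 2N′ where N′ = N/2. For fixed a each point agrees with at most one shift
-- b + ⟨a, x′⟩, so Σ_b u_b ≤ N′ and Σ_c v_c ≤ N′, and the induction step reduces to the inequality
-- Σ_{b,c} (2(u_b + v_c) ∸ 2N′)² ≤ 2 Σ_b (2u_b ∸ N′)² + 2 Σ_c (2v_c ∸ N′)² for such lists. If max v ≤ max u = p,
-- every other u is at most N′ − p, so only the row of p contributes; in that row the largest v is treated
-- separately, and the others have total excess at most p − max v.

module Submission where

open import Defs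
open import Data.Nat using (ℕ; _≤_)
open import Data.Integer using (+_)
open import Data.Bool using (Bool)
open import Data.Vec using (Vec)
open import Data.List using (List; map; length)
open import Data.List.Relation.Unary.All using (All)
open import Data.List.Relation.Unary.AllPairs using (AllPairs)
open import Data.Product using (∃; _×_)
open import Data.Sum using (_⊎_)
open import Relation.Nullary using (¬_)
open import Relation.Binary.PropositionalEquality using (_≡_)
open import Data.Rational as ℚ using (ℚ; 0ℚ; 1ℚ; _/_; _-_; 1/_; positive)
open import Data.Rational.Properties using (pos⇒nonZero)

open import Level using (0ℓ)
open import Function using (_∘_)
open import Data.Empty using (⊥-elim)
open import Data.Bool using (true; false)
open import Data.Sum using (inj₁; inj₂)
open import Data.Product using (_,_; proj₁; proj₂)
open import Data.Nat using (zero; suc; _+_; _*_; _∸_; _^_; _⊔_; _≤?_; z≤n; s≤s; NonZero)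
open import Data.Nat.Properties hiding (_≟_)
open import Algebra.Properties.CommutativeSemigroup +-commutativeSemigroup using (interchange; x∙yz≈y∙xz)
open import Data.Nat.ListAction using (sum)
open import Data.Nat.ListAction.Properties using (sum-++)
open import Data.Nat.Tactic.RingSolver using (solve-∀)
import Data.Integer as ℤ
import Data.Integer.Properties as ℤ
import Data.Integer.Tactic.RingSolver as ℤ-Solver
open import Data.Rational using (toℚᵘ)
import Data.Rational.Properties as ℚ
import Data.Rational.Solver as ℚ-Solver
import Data.Rational.Unnormalised as ℚᵘ
import Data.Rational.Unnormalised.Properties as ℚᵘ
open import Data.Rational.Unnormalised using (*≡*; *≤*)
open import Data.Vec using ([]; _∷_)
import Data.Vec.Relation.Binary.Pointwise.Inductive as Pointwise
open Pointwise using (Pointwise; []; _∷_)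
open import Data.List using ([]; _∷_; _++_; foldr; filter; tabulate; concatMap; cartesianProductWith)
open import Data.List.Properties using (map-cong; map-∘; map-++; map-id; length-++; length-map)
open import Data.List.Relation.Unary.All as All using ([]; _∷_)
import Data.List.Relation.Unary.All.Properties as Allₚ
open import Data.List.Relation.Unary.AllPairs as AllPairs using ([]; _∷_)
open import Data.List.Relation.Unary.Any as Any using (here; there)
open import Data.List.Relation.Unary.Unique.Setoid using (Unique)
import Data.List.Relation.Unary.Unique.Setoid.Properties as Uniqueₚ
open import Data.List.Relation.Unary.Enumerates.Setoid using (IsEnumeration)
import Data.List.Membership.Setoid as Membership
open import Data.List.Membership.Setoid.Properties using (∈-resp-≈; ∈-tabulate⁺; ∈-cartesianProductWith⁺; ∈-concatMap⁺)
open import Data.Product.Relation.Binary.Pointwise.NonDependent using (×-decSetoid)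
open import Relation.Nullary using (Dec; yes; no; ¬?)
open import Relation.Unary using (Decidable)
open import Relation.Binary.Bundles using (Setoid; DecSetoid)
import Relation.Binary.Construct.On as On
import Relation.Binary.Reasoning.Setoid as SetoidReasoning
open import Relation.Binary.PropositionalEquality using (refl; sym; trans; cong; cong₂; subst; subst₂; module ≡-Reasoning)

infix 7.5 ∑
∑ : {A : Set} → List A → (A → ℕ) → ℕ
∑ xs f = sum (map f xs)

syntax ∑ xs (λ x → e) = ∑[ x ∈ xs ] e

module _ {A : Set} where

  ∑-cong : ∀ {f g : A → ℕ} → (∀ x → f x ≡ g x) → ∀ xs → ∑ xs f ≡ ∑ xs g
  ∑-cong f≗g xs = cong sum (map-cong f≗g xs)

  ∑-mono-≤ : ∀ {f g : A → ℕ} → (∀ x → f x ≤ g x) → ∀ xs → ∑ xs f ≤ ∑ xs g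
  ∑-mono-≤ f≤g []       = z≤n
  ∑-mono-≤ f≤g (x ∷ xs) = +-mono-≤ (f≤g x) (∑-mono-≤ f≤g xs)

  ∑-zero : ∀ {f : A → ℕ} {xs} → All (λ x → f x ≡ 0) xs → ∑ xs f ≡ 0
  ∑-zero []            = refl
  ∑-zero (fx≡0 ∷ fxs≡0) = cong₂ _+_ fx≡0 (∑-zero fxs≡0)

  ∑-++ : ∀ (f : A → ℕ) xs ys → ∑ (xs ++ ys) f ≡ ∑ xs f + ∑ ys f
  ∑-++ f xs ys = trans (cong sum (map-++ f xs ys)) (sum-++ (map f xs) (map f ys))

  ∑-+ : ∀ (f g : A → ℕ) xs → ∑[ x ∈ xs ] (f x + g x) ≡ ∑ xs f + ∑ xs g
  ∑-+ f g []       = refl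
  ∑-+ f g (x ∷ xs) = trans (cong (_+_ (f x + g x)) (∑-+ f g xs)) (interchange (f x) (g x) _ _)

  ∑-*ˡ : ∀ k (f : A → ℕ) xs → ∑[ x ∈ xs ] (k * f x) ≡ k * ∑ xs f
  ∑-*ˡ k f []       = sym (*-zeroʳ k)
  ∑-*ˡ k f (x ∷ xs) = trans (cong (_+_ (k * f x)) (∑-*ˡ k f xs)) (sym (*-distribˡ-+ k (f x) _))

  ∑-*ʳ : ∀ k (f : A → ℕ) xs → ∑[ x ∈ xs ] (f x * k) ≡ ∑ xs f * k
  ∑-*ʳ k f xs = trans (∑-cong (λ x → *-comm (f x) k) xs) (trans (∑-*ˡ k f xs) (*-comm k _))

  ∑-const-1 : ∀ (xs : List A) → ∑[ x ∈ xs ] 1 ≡ length xs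
  ∑-const-1 []       = refl
  ∑-const-1 (x ∷ xs) = cong suc (∑-const-1 xs)

module _ {A B : Set} where

  ∑-map : ∀ (f : B → ℕ) (g : A → B) xs → ∑ (map g xs) f ≡ ∑ xs (f ∘ g)
  ∑-map f g xs = cong sum (sym (map-∘ xs))

  ∑-concatMap : ∀ (f : B → ℕ) (g : A → List B) xs → ∑ (concatMap g xs) f ≡ ∑[ x ∈ xs ] ∑ (g x) f
  ∑-concatMap f g []       = refl
  ∑-concatMap f g (x ∷ xs) = trans (∑-++ f (g x) (concatMap g xs)) (cong (_+_ (∑ (g x) f)) (∑-concatMap f g xs))

  ∑-comm : ∀ (f : A → B → ℕ) xs ys → ∑[ x ∈ xs ] ∑[ y ∈ ys ] f x y ≡ ∑[ y ∈ ys ] ∑[ x ∈ xs ] f x y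
  ∑-comm f []       ys = sym (∑-zero (All.universal (λ _ → refl) ys))
  ∑-comm f (x ∷ xs) ys = trans (cong (_+_ (∑[ y ∈ ys ] f x y)) (∑-comm f xs ys)) (sym (∑-+ (f x) _ ys))

∑-cartesianProductWith : ∀ {A B C : Set} (f : C → ℕ) (g : A → B → C) xs ys →
  ∑ (cartesianProductWith g xs ys) f ≡ ∑[ x ∈ xs ] ∑[ y ∈ ys ] f (g x y)
∑-cartesianProductWith f g []       ys = refl
∑-cartesianProductWith f g (x ∷ xs) ys = begin
  ∑ (map (g x) ys ++ cartesianProductWith g xs ys) f
    ≡⟨ ∑-++ f (map (g x) ys) _ ⟩
  ∑ (map (g x) ys) f + ∑ (cartesianProductWith g xs ys) f
    ≡⟨ cong₂ _+_ (∑-map f (g x) ys) (∑-cartesianProductWith f g xs ys) ⟩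
  ∑[ y ∈ ys ] f (g x y) + ∑[ x ∈ xs ] ∑[ y ∈ ys ] f (g x y)
    ∎
  where open ≡-Reasoning

infix 8 _²
_² : ℕ → ℕ
n ² = n * n

excess : ℕ → ℕ → ℕ
excess N a = 2 * a ∸ N

excess-zero² : ∀ N → excess N 0 ² ≡ 0
excess-zero² N = cong _² (0∸n≡0 N)

maximum : List ℕ → ℕ
maximum = foldr _⊔_ 0

dropMaximum : List ℕ → List ℕ
dropMaximum []       = []
dropMaximum (x ∷ xs) with maximum xs ≤? x
... | yes _ = xs
... | no  _ = x ∷ dropMaximum xs

-- Since maximum [] = 0, the decomposition needs f 0 ≡ 0.
∑-maximum : ∀ (f : ℕ → ℕ) → f 0 ≡ 0 → ∀ xs → ∑ xs f ≡ f (maximum xs) + ∑ (dropMaximum xs) f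
∑-maximum f f0≡0 []       = sym (cong (_+ 0) f0≡0)
∑-maximum f f0≡0 (x ∷ xs) with maximum xs ≤? x
... | yes m≤x rewrite m≥n⇒m⊔n≡m m≤x = refl
... | no  m≰x rewrite m≤n⇒m⊔n≡n (<⇒≤ (≰⇒> m≰x)) | ∑-maximum f f0≡0 xs = x∙yz≈y∙xz (f x) (f (maximum xs)) _

sum-dropMaximum : ∀ xs → maximum xs + sum (dropMaximum xs) ≡ sum xs
sum-dropMaximum xs = begin
  maximum xs + sum (dropMaximum xs)        ≡⟨ cong (λ ys → maximum xs + sum ys) (map-id (dropMaximum xs)) ⟨
  maximum xs + ∑[ x ∈ dropMaximum xs ] x   ≡⟨ ∑-maximum (λ x → x) refl xs ⟨
  ∑[ x ∈ xs ] x                            ≡⟨ cong sum (map-id xs) ⟩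
  sum xs                                   ∎
  where open ≡-Reasoning

f[maximum]≤∑ : ∀ (f : ℕ → ℕ) → f 0 ≡ 0 → ∀ xs → f (maximum xs) ≤ ∑ xs f
f[maximum]≤∑ f f0≡0 xs = ≤-trans (m≤m+n _ _) (≤-reflexive (sym (∑-maximum f f0≡0 xs)))

sum-dropMaximum≤ : ∀ {N} xs → sum xs ≤ N → sum (dropMaximum xs) ≤ N ∸ maximum xs
sum-dropMaximum≤ {N} xs Σxs≤N =
  m+n≤o⇒m≤o∸n _ (≤-trans (≤-reflexive (trans (+-comm _ (maximum xs)) (sum-dropMaximum xs))) Σxs≤N)

maximum≤sum : ∀ xs → maximum xs ≤ sum xs
maximum≤sum []       = z≤n
maximum≤sum (x ∷ xs) = ≤-trans (⊔-monoʳ-≤ x (maximum≤sum xs)) (m⊔n≤m+n x (sum xs))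

≤-maximum : ∀ xs → All (_≤ maximum xs) xs
≤-maximum []       = []
≤-maximum (x ∷ xs) = m≤m⊔n x _ ∷ All.map (λ y≤ → ≤-trans y≤ (m≤n⊔m x _)) (≤-maximum xs)

All-dropMaximum : ∀ {P : ℕ → Set} xs → All P xs → All P (dropMaximum xs)
All-dropMaximum []       []         = []
All-dropMaximum (x ∷ xs) (px ∷ pxs) with maximum xs ≤? x
... | yes _ = pxs
... | no  _ = px ∷ All-dropMaximum xs pxs

≤-sum : ∀ xs → All (_≤ sum xs) xs
≤-sum []       = []
≤-sum (x ∷ xs) = m≤m+n x _ ∷ All.map (λ y≤ → ≤-trans y≤ (m≤n+m _ x)) (≤-sum xs)

∸-superadditive : ∀ c x y → (x ∸ c) + (y ∸ c) ≤ x + y ∸ c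
∸-superadditive c x y with x ≤? c
... | yes x≤c rewrite m≤n⇒m∸n≡0 x≤c = ∸-monoˡ-≤ c (m≤n+m y x)
... | no  x≰c rewrite +-∸-comm {x} y {c} (<⇒≤ (≰⇒> x≰c)) = +-monoʳ-≤ (x ∸ c) (m∸n≤m y c)

∑-∸≤sum-∸ : ∀ c xs → ∑[ x ∈ xs ] (x ∸ c) ≤ sum xs ∸ c
∑-∸≤sum-∸ c []       = z≤n
∑-∸≤sum-∸ c (x ∷ xs) = ≤-trans (+-monoʳ-≤ (x ∸ c) (∑-∸≤sum-∸ c xs)) (∸-superadditive c x (sum xs))

∑-²≤sum² : ∀ xs → ∑ xs _² ≤ sum xs ²
∑-²≤sum² []       = z≤n
∑-²≤sum² (x ∷ xs) = begin
  x ² + ∑ xs _²                    ≤⟨ +-monoʳ-≤ (x ²) (∑-²≤sum² xs) ⟩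
  x ² + sum xs ²                   ≤⟨ m≤m+n _ (2 * x * sum xs) ⟩
  x ² + sum xs ² + 2 * x * sum xs  ≡⟨ square-sum x (sum xs) ⟩
  (x + sum xs) ²                   ∎
  where
  open ≤-Reasoning
  square-sum : ∀ a b → a * a + b * b + 2 * a * b ≡ (a + b) * (a + b)
  square-sum = solve-∀

∑-²≤max*sum : ∀ {m} xs → All (_≤ m) xs → ∑ xs _² ≤ m * sum xs
∑-²≤max*sum     []       []           = z≤n
∑-²≤max*sum {m} (x ∷ xs) (x≤m ∷ xs≤m) =
  ≤-trans (+-mono-≤ (*-monoˡ-≤ x x≤m) (∑-²≤max*sum xs xs≤m)) (≤-reflexive (sym (*-distribˡ-+ m x (sum xs))))

m≡n+o⇒m∸n≡o : ∀ {m} n {o} → m ≡ n + o → m ∸ n ≡ o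
m≡n+o⇒m∸n≡o n {o} refl = m+n∸m≡n n o

excess-larger : ∀ {p q N} → q ≤ p → N ≤ p + q → excess N p ≡ (p + q ∸ N) + (p ∸ q)
excess-larger {p} {q} {N} q≤p N≤p+q = m≡n+o⇒m∸n≡o N (begin
  2 * p                          ≡⟨ double p ⟩
  p + p                          ≡⟨ cong (_+_ p) (m+[n∸m]≡n q≤p) ⟨
  p + (q + (p ∸ q))              ≡⟨ +-assoc p q _ ⟨
  p + q + (p ∸ q)                ≡⟨ cong (_+ (p ∸ q)) (m+[n∸m]≡n N≤p+q) ⟨
  N + (p + q ∸ N) + (p ∸ q)      ≡⟨ +-assoc N _ _ ⟩
  N + ((p + q ∸ N) + (p ∸ q))    ∎)
  where
  open ≡-Reasoning
  double : ∀ n → 2 * n ≡ n + n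
  double = solve-∀

excess-smaller : ∀ {p q N} → q ≤ p → N ≤ p + q → excess N q ≡ (p + q ∸ N) ∸ (p ∸ q)
excess-smaller {p} {q} {N} q≤p N≤p+q = begin
  2 * q ∸ N                          ≡⟨ [m+n]∸[m+o]≡n∸o (p ∸ q) (2 * q) N ⟨
  (p ∸ q) + 2 * q ∸ ((p ∸ q) + N)    ≡⟨ cong₂ _∸_ shift (+-comm (p ∸ q) N) ⟩
  N + (p + q ∸ N) ∸ (N + (p ∸ q))    ≡⟨ [m+n]∸[m+o]≡n∸o N _ _ ⟩
  (p + q ∸ N) ∸ (p ∸ q)              ∎
  where
  open ≡-Reasoning
  regroup : ∀ d q → d + 2 * q ≡ d + q + q
  regroup = solve-∀
  shift : (p ∸ q) + 2 * q ≡ N + (p + q ∸ N)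
  shift = trans (regroup (p ∸ q) q) (trans (cong (_+ q) (m∸n+n≡m q≤p)) (sym (m+[n∸m]≡n N≤p+q)))

square-estimate-≤ : ∀ {a d B} → a ≤ d → B ≤ a * d → (2 * a) ² + 4 * B ≤ 2 * (a + d) ² + 2 * (a ∸ d) ²
square-estimate-≤ {a} {B = B} a≤d B≤ad with m≤n⇒∃[o]m+o≡n a≤d
... | k , refl rewrite m≤n⇒m∸n≡0 (m≤m+n a k) = begin
  (2 * a) ² + 4 * B                                             ≤⟨ +-monoʳ-≤ ((2 * a) ²) (*-monoʳ-≤ 4 B≤ad) ⟩
  (2 * a) ² + 4 * (a * (a + k))                                 ≤⟨ m≤m+n _ (4 * (a * k) + 2 * k ²) ⟩
  (2 * a) ² + 4 * (a * (a + k)) + (4 * (a * k) + 2 * k ²)       ≡⟨ expand a k ⟩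
  2 * (a + (a + k)) ² + 2 * 0 ²                                 ∎
  where
  open ≤-Reasoning
  expand : ∀ a k → (2 * a) * (2 * a) + 4 * (a * (a + k)) + (4 * (a * k) + 2 * (k * k))
                   ≡ 2 * ((a + (a + k)) * (a + (a + k))) + 2 * (0 * 0)
  expand = solve-∀

square-estimate-≥ : ∀ {a d B} → d ≤ a → B ≤ d ² → (2 * a) ² + 4 * B ≤ 2 * (a + d) ² + 2 * (a ∸ d) ²
square-estimate-≥ {d = d} {B} d≤a B≤d² with m≤n⇒∃[o]m+o≡n d≤a
... | y , refl rewrite m+n∸m≡n d y = begin
  (2 * (d + y)) ² + 4 * B               ≤⟨ +-monoʳ-≤ ((2 * (d + y)) ²) (*-monoʳ-≤ 4 B≤d²) ⟩
  (2 * (d + y)) ² + 4 * d ²             ≡⟨ expand d y ⟩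
  2 * (d + y + d) ² + 2 * y ²           ∎
  where
  open ≤-Reasoning
  expand : ∀ d y → (2 * (d + y)) * (2 * (d + y)) + 4 * (d * d) ≡ 2 * ((d + y + d) * (d + y + d)) + 2 * (y * y)
  expand = solve-∀

square-estimate : ∀ {a d B} → B ≤ a * d → B ≤ d ² → (2 * a) ² + 4 * B ≤ 2 * (a + d) ² + 2 * (a ∸ d) ²
square-estimate {a} {d} B≤ad B≤d² with ≤-total a d
... | inj₁ a≤d = square-estimate-≤ a≤d B≤ad
... | inj₂ d≤a = square-estimate-≥ d≤a B≤d²

two-largest-estimate : ∀ {p q N B} → q ≤ p → B ≤ (p + q ∸ N) * (p ∸ q) → B ≤ (p ∸ q) ² →
  (2 * (p + q ∸ N)) ² + 4 * B ≤ 2 * excess N p ² + 2 * excess N q ²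
two-largest-estimate {p} {q} {N} q≤p B≤ad B≤d² with N ≤? p + q
... | no N≰p+q rewrite m≤n⇒m∸n≡0 (<⇒≤ (≰⇒> N≰p+q)) | n≤0⇒n≡0 B≤ad = z≤n
... | yes N≤p+q rewrite excess-larger q≤p N≤p+q | excess-smaller q≤p N≤p+q =
  square-estimate {p + q ∸ N} {p ∸ q} B≤ad B≤d²

∑-dropMaximum-shift≤ : ∀ {p N} V → p ≤ N → maximum V ≤ p → sum V ≤ N →
  ∑[ v ∈ dropMaximum V ] (p + v ∸ N) ≤ p ∸ maximum V
∑-dropMaximum-shift≤ {p} {N} V p≤N q≤p ΣV≤N = begin
  ∑[ v ∈ O ] (p + v ∸ N)     ≡⟨ ∑-cong shift O ⟩
  ∑[ v ∈ O ] (v ∸ (N ∸ p))   ≤⟨ ∑-∸≤sum-∸ (N ∸ p) O ⟩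
  sum O ∸ (N ∸ p)            ≤⟨ ∸-monoˡ-≤ (N ∸ p) (sum-dropMaximum≤ V ΣV≤N) ⟩
  (N ∸ q) ∸ (N ∸ p)          ≡⟨ m≡n+o⇒m∸n≡o (N ∸ p) N∸q≡[N∸p]+[p∸q] ⟩
  p ∸ q                      ∎
  where
  open ≤-Reasoning
  q = maximum V
  O = dropMaximum V
  shift : ∀ v → p + v ∸ N ≡ v ∸ (N ∸ p)
  shift v = trans (cong (p + v ∸_) (sym (m+[n∸m]≡n p≤N))) ([m+n]∸[m+o]≡n∸o p v (N ∸ p))
  N∸q≡[N∸p]+[p∸q] : N ∸ q ≡ (N ∸ p) + (p ∸ q)
  N∸q≡[N∸p]+[p∸q] = begin-equality
    N ∸ q                  ≡⟨ cong (_∸ q) (m+[n∸m]≡n p≤N) ⟨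
    p + (N ∸ p) ∸ q        ≡⟨ +-∸-comm (N ∸ p) q≤p ⟩
    (p ∸ q) + (N ∸ p)      ≡⟨ +-comm (p ∸ q) (N ∸ p) ⟩
    (N ∸ p) + (p ∸ q)      ∎

row-estimate : ∀ {p N} V → p ≤ N → maximum V ≤ p → sum V ≤ N →
  ∑[ v ∈ V ] (2 * (p + v ∸ N)) ² ≤ 2 * excess N p ² + 2 * ∑[ v ∈ V ] excess N v ²
row-estimate {p} {N} V p≤N q≤p ΣV≤N = begin
  ∑ V t                                      ≡⟨ ∑-maximum t t0≡0 V ⟩
  t q + ∑ O t                                ≡⟨ cong (_+_ (t q)) ∑t≡4B ⟩
  (2 * a) ² + 4 * B                          ≤⟨ two-largest-estimate {N = N} q≤p B≤ad B≤d² ⟩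
  2 * excess N p ² + 2 * excess N q ²        ≤⟨ +-monoʳ-≤ (2 * excess N p ²)
                                                  (*-monoʳ-≤ 2 (f[maximum]≤∑ (λ v → excess N v ²) (excess-zero² N) V)) ⟩
  2 * excess N p ² + 2 * ∑[ v ∈ V ] excess N v ² ∎
  where
  open ≤-Reasoning
  q = maximum V
  O = dropMaximum V
  w : ℕ → ℕ
  w v = p + v ∸ N
  t : ℕ → ℕ
  t v = (2 * w v) ²
  a = w q
  B = ∑ (map w O) _²
  square-double : ∀ x → (2 * x) * (2 * x) ≡ 4 * (x * x)
  square-double = solve-∀
  t0≡0 : t 0 ≡ 0
  t0≡0 = cong (λ x → (2 * x) ²) (m≤n⇒m∸n≡0 (≤-trans (≤-reflexive (+-identityʳ p)) p≤N))
  ∑t≡4B : ∑ O t ≡ 4 * B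
  ∑t≡4B = trans (∑-cong (λ v → square-double (w v)) O)
                (trans (∑-*ˡ 4 (λ v → w v ²) O) (cong (4 *_) (sym (∑-map _² w O))))
  S≤d : ∑ O w ≤ p ∸ q
  S≤d = ∑-dropMaximum-shift≤ V p≤N q≤p ΣV≤N
  w≤a : All (λ v → w v ≤ a) O
  w≤a = All-dropMaximum V (All.map (λ v≤q → ∸-monoˡ-≤ N (+-monoʳ-≤ p v≤q)) (≤-maximum V))
  B≤ad : B ≤ a * (p ∸ q)
  B≤ad = ≤-trans (∑-²≤max*sum (map w O) (Allₚ.map⁺ w≤a)) (*-monoʳ-≤ a S≤d)
  B≤d² : B ≤ (p ∸ q) ²
  B≤d² = ≤-trans (∑-²≤sum² (map w O)) (*-mono-≤ S≤d S≤d)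

excess-double : ∀ N x → excess (2 * N) x ≡ 2 * (x ∸ N)
excess-double N x = sym (*-distribˡ-∸ 2 x N)

row-vanishes : ∀ {N u} V → u + maximum V ≤ N → ∑[ v ∈ V ] excess (2 * N) (u + v) ² ≡ 0
row-vanishes {N} {u} V u+q≤N = ∑-zero (All.map vanish (≤-maximum V))
  where
  vanish : ∀ {v} → v ≤ maximum V → excess (2 * N) (u + v) ² ≡ 0
  vanish v≤q = cong _² (m≤n⇒m∸n≡0 (*-monoʳ-≤ 2 (≤-trans (+-monoʳ-≤ u v≤q) u+q≤N)))

∑∑-excess²≤-ordered : ∀ {N} U V → sum U ≤ N → sum V ≤ N → maximum V ≤ maximum U →
  ∑[ u ∈ U ] ∑[ v ∈ V ] excess (2 * N) (u + v) ² ≤ 2 * ∑[ u ∈ U ] excess N u ² + 2 * ∑[ v ∈ V ] excess N v ²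
∑∑-excess²≤-ordered {N} U V ΣU≤N ΣV≤N q≤p = begin
  ∑ U R                                          ≡⟨ ∑-maximum R R0≡0 U ⟩
  R p + ∑ (dropMaximum U) R                      ≡⟨ cong (_+_ (R p)) (∑-zero (All.map (row-vanishes V) rest-small)) ⟩
  R p + 0                                        ≡⟨ +-identityʳ (R p) ⟩
  R p                                            ≡⟨ ∑-cong (λ v → cong _² (excess-double N (p + v))) V ⟩
  ∑[ v ∈ V ] (2 * (p + v ∸ N)) ²                 ≤⟨ row-estimate V p≤N q≤p ΣV≤N ⟩
  2 * excess N p ² + 2 * ∑[ v ∈ V ] excess N v ² ≤⟨ +-monoˡ-≤ (2 * ∑[ v ∈ V ] excess N v ²)
                                                     (*-monoʳ-≤ 2 (f[maximum]≤∑ (λ u → excess N u ²) (excess-zero² N) U)) ⟩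
  2 * ∑[ u ∈ U ] excess N u ² + 2 * ∑[ v ∈ V ] excess N v ² ∎
  where
  open ≤-Reasoning
  p = maximum U
  R : ℕ → ℕ
  R u = ∑[ v ∈ V ] excess (2 * N) (u + v) ²
  p≤N : p ≤ N
  p≤N = ≤-trans (maximum≤sum U) ΣU≤N
  R0≡0 : R 0 ≡ 0
  R0≡0 = row-vanishes V (≤-trans (maximum≤sum V) ΣV≤N)
  rest-small : All (λ u → u + maximum V ≤ N) (dropMaximum U)
  rest-small = All.map (λ u≤ → ≤-trans (+-mono-≤ (≤-trans u≤ (sum-dropMaximum≤ U ΣU≤N)) q≤p)
                                       (≤-reflexive (m∸n+n≡m p≤N)))
                       (≤-sum (dropMaximum U))

∑∑-excess²≤ : ∀ {N} U V → sum U ≤ N → sum V ≤ N →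
  ∑[ u ∈ U ] ∑[ v ∈ V ] excess (2 * N) (u + v) ² ≤ 2 * ∑[ u ∈ U ] excess N u ² + 2 * ∑[ v ∈ V ] excess N v ²
∑∑-excess²≤ {N} U V ΣU≤N ΣV≤N with maximum V ≤? maximum U
... | yes q≤p = ∑∑-excess²≤-ordered U V ΣU≤N ΣV≤N q≤p
... | no  q≰p = begin
  ∑[ u ∈ U ] ∑[ v ∈ V ] excess (2 * N) (u + v) ²
    ≡⟨ ∑-comm (λ u v → excess (2 * N) (u + v) ²) U V ⟩
  ∑[ v ∈ V ] ∑[ u ∈ U ] excess (2 * N) (u + v) ²
    ≡⟨ ∑-cong (λ v → ∑-cong (λ u → cong (λ x → excess (2 * N) x ²) (+-comm u v)) U) V ⟩
  ∑[ v ∈ V ] ∑[ u ∈ U ] excess (2 * N) (v + u) ²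
    ≤⟨ ∑∑-excess²≤-ordered V U ΣV≤N ΣU≤N (<⇒≤ (≰⇒> q≰p)) ⟩
  2 * ∑[ v ∈ V ] excess N v ² + 2 * ∑[ u ∈ U ] excess N u ²
    ≡⟨ +-comm (2 * ∑[ v ∈ V ] excess N v ²) _ ⟩
  2 * ∑[ u ∈ U ] excess N u ² + 2 * ∑[ v ∈ V ] excess N v ²
    ∎
  where open ≤-Reasoning

2*m≤m+n⇒m≤n : ∀ {m n} → 2 * m ≤ m + n → m ≤ n
2*m≤m+n⇒m≤n {m} {n} = +-cancelˡ-≤ m m n ∘ subst (_≤ m + n) (cong (_+_ m) (+-identityʳ m))

excess-complement : ∀ {d a N} → d + a ≡ N → 2 * d ≤ N → 2 * d + excess N a ≡ N
excess-complement {d} {a} refl 2d≤N with m≤n⇒∃[o]m+o≡n (2*m≤m+n⇒m≤n {d} {a} 2d≤N)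
... | k , refl = trans (cong (_+_ (2 * d)) (m≡n+o⇒m∸n≡o (d + (d + k)) (double d k))) (regroup d k)
  where
  double : ∀ d k → 2 * (d + k) ≡ d + (d + k) + k
  double = solve-∀
  regroup : ∀ d k → 2 * d + k ≡ d + (d + k)
  regroup = solve-∀

𝟙[_] : {P : Set} → Dec P → ℕ
𝟙[ yes _ ] = 1
𝟙[ no  _ ] = 0

𝟙-yes : ∀ {P : Set} (p? : Dec P) → P → 𝟙[ p? ] ≡ 1
𝟙-yes (yes _) _ = refl
𝟙-yes (no ¬p) p = ⊥-elim (¬p p)

𝟙-no : ∀ {P : Set} (p? : Dec P) → ¬ P → 𝟙[ p? ] ≡ 0
𝟙-no (yes p) ¬p = ⊥-elim (¬p p)
𝟙-no (no _)  _  = refl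

module _ (S : DecSetoid 0ℓ 0ℓ) where
  open DecSetoid S renaming (Carrier to A; refl to ≈-refl; sym to ≈-sym; trans to ≈-trans)
  open import Data.List.Membership.Setoid setoid using (_∈_)

  𝟙-congʳ : ∀ {x y z} → y ≈ z → 𝟙[ x ≟ y ] ≡ 𝟙[ x ≟ z ]
  𝟙-congʳ {x} {y} {z} y≈z with x ≟ y
  ... | yes x≈y = sym (𝟙-yes (x ≟ z) (≈-trans x≈y y≈z))
  ... | no  x≉y = sym (𝟙-no (x ≟ z) (λ x≈z → x≉y (≈-trans x≈z (≈-sym y≈z))))

  ∑-𝟙-unique : ∀ x {ys} → Unique setoid ys → ∑[ y ∈ ys ] 𝟙[ x ≟ y ] ≤ 1
  ∑-𝟙-unique x {[]}     _             = z≤n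
  ∑-𝟙-unique x {y ∷ ys} (y≉ys ∷ ys!) with x ≟ y
  ... | yes x≈y = s≤s (≤-reflexive (∑-zero (All.map (λ y≉z → 𝟙-no (x ≟ _) (y≉z ∘ ≈-trans (≈-sym x≈y))) y≉ys)))
  ... | no  _   = ∑-𝟙-unique x ys!

  -- Each x ∈ xs is matched by some y ≈ x in ys, and each y ∈ ys by at most one x ∈ xs.
  ∑-unique≤∑-enumeration : ∀ (f : A → ℕ) → (∀ {x y} → x ≈ y → f x ≡ f y) →
    ∀ {xs ys} → Unique setoid xs → IsEnumeration setoid ys → ∑ xs f ≤ ∑ ys f
  ∑-unique≤∑-enumeration f f-resp {xs} {ys} xs! ys-complete = begin
    ∑ xs f
      ≤⟨ ∑-mono-≤ (λ x → ≤-∑𝟙* (ys-complete x)) xs ⟩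
    ∑[ x ∈ xs ] ∑[ y ∈ ys ] (𝟙[ y ≟ x ] * f y)
      ≡⟨ ∑-comm (λ x y → 𝟙[ y ≟ x ] * f y) xs ys ⟩
    ∑[ y ∈ ys ] ∑[ x ∈ xs ] (𝟙[ y ≟ x ] * f y)
      ≡⟨ ∑-cong (λ y → ∑-*ʳ (f y) (λ x → 𝟙[ y ≟ x ]) xs) ys ⟩
    ∑[ y ∈ ys ] (∑[ x ∈ xs ] 𝟙[ y ≟ x ] * f y)
      ≤⟨ ∑-mono-≤ (λ y → *-monoˡ-≤ (f y) (∑-𝟙-unique y xs!)) ys ⟩
    ∑[ y ∈ ys ] (1 * f y)
      ≡⟨ ∑-cong (λ y → *-identityˡ (f y)) ys ⟩
    ∑ ys f
      ∎
    where
    open ≤-Reasoning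
    ≤-∑𝟙* : ∀ {x zs} → x ∈ zs → f x ≤ ∑[ z ∈ zs ] (𝟙[ z ≟ x ] * f z)
    ≤-∑𝟙* {x} {z ∷ _} (here x≈z) rewrite 𝟙-yes (z ≟ x) (≈-sym x≈z) | f-resp x≈z | +-identityʳ (f z) =
      m≤m+n (f z) _
    ≤-∑𝟙* (there x∈zs) = ≤-trans (≤-∑𝟙* x∈zs) (m≤n+m _ _)

length-filter-¬+∑𝟙 : ∀ {A : Set} {P : A → Set} (P? : Decidable P) xs →
  length (filter (¬? ∘ P?) xs) + ∑[ x ∈ xs ] 𝟙[ P? x ] ≡ length xs
length-filter-¬+∑𝟙 P? []       = refl
length-filter-¬+∑𝟙 P? (x ∷ xs) with P? x
... | yes _ = trans (+-suc _ _) (cong suc (length-filter-¬+∑𝟙 P? xs))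
... | no  _ = cong suc (length-filter-¬+∑𝟙 P? xs)

length-cube : ∀ n → length (cube n) ≡ 2 ^ n
length-cube zero    = refl
length-cube (suc n) = begin
  length (map (false ∷_) (cube n) ++ map (true ∷_) (cube n))
    ≡⟨ length-++ (map (false ∷_) (cube n)) ⟩
  length (map (false ∷_) (cube n)) + length (map (true ∷_) (cube n))
    ≡⟨ cong₂ _+_ (length-map _ (cube n)) (length-map _ (cube n)) ⟩
  length (cube n) + length (cube n)
    ≡⟨ cong₂ _+_ (length-cube n) (length-cube n) ⟩
  2 ^ n + 2 ^ n
    ≡⟨ cong (_+_ (2 ^ n)) (+-identityʳ (2 ^ n)) ⟨
  2 ^ suc n
    ∎
  where open ≡-Reasoning

module _ (G : FiniteAbelianGroup) where
  open FiniteAbelianGroup G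
    using (Carrier; _≈_; _∙_; _⁻¹; ε; _≟_; setoid; isEquivalence; ∙-cong; ∙-congˡ; ∙-congʳ; ⁻¹-cong;
           assoc; comm; identityˡ; enum; enum-inj; enum-surj)
    renaming (refl to ≈-refl; sym to ≈-sym; trans to ≈-trans; grp to abelianGroup)
  open import Algebra.Properties.AbelianGroup abelianGroup using (xyx⁻¹≈y; //-rightDividesˡ; ∙-cancelʳ)

  carrierDecSetoid : DecSetoid 0ℓ 0ℓ
  carrierDecSetoid = record { isDecEquivalence = record { isEquivalence = isEquivalence ; _≟_ = _≟_ } }

  vecSetoid : ℕ → Setoid 0ℓ 0ℓ
  vecSetoid = Pointwise.setoid setoid

  coefficients : ∀ {n} → Poly₁ G n → Carrier × Vec Carrier n
  coefficients (poly a₀ as) = a₀ , as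

  polyDecSetoid : ℕ → DecSetoid 0ℓ 0ℓ
  polyDecSetoid n = On.decSetoid (×-decSetoid carrierDecSetoid (Pointwise.decSetoid carrierDecSetoid n)) coefficients

  polySetoid : ℕ → Setoid 0ℓ 0ℓ
  polySetoid n = DecSetoid.setoid (polyDecSetoid n)

  _≋_ : ∀ {n} → Poly₁ G n → Poly₁ G n → Set
  _≋_ {n} = Setoid._≈_ (polySetoid n)

  linSum-cong : ∀ {n} {as bs : Vec Carrier n} → Pointwise _≈_ as bs → ∀ x → linSum G as x ≈ linSum G bs x
  linSum-cong []               []          = ≈-refl
  linSum-cong (a≈b ∷ as≈bs) (true  ∷ x) = ∙-cong a≈b (linSum-cong as≈bs x)
  linSum-cong (a≈b ∷ as≈bs) (false ∷ x) = ∙-congˡ (linSum-cong as≈bs x)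

  evalP-cong : ∀ {n} {P Q : Poly₁ G n} → P ≋ Q → ∀ x → evalP G P x ≈ evalP G Q x
  evalP-cong {P = poly _ _} {poly _ _} (a₀≈b₀ , as≈bs) x = ∙-cong a₀≈b₀ (linSum-cong as≈bs x)

  agreements : ∀ {n} → (Vec Bool n → Carrier) → (Vec Bool n → Carrier) → ℕ
  agreements {n} f g = ∑[ x ∈ cube n ] 𝟙[ f x ≟ g x ]

  disagree+agreements : ∀ {n} (f g : Vec Bool n → Carrier) → disagree G f g + agreements f g ≡ 2 ^ n
  disagree+agreements {n} f g = trans (length-filter-¬+∑𝟙 (λ x → f x ≟ g x) (cube n)) (length-cube n)

  agreements-congʳ : ∀ {n} (f : Vec Bool n → Carrier) {g h} → (∀ x → g x ≈ h x) → agreements f g ≡ agreements f h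
  agreements-congʳ {n} f g≈h = ∑-cong (λ x → 𝟙-congʳ carrierDecSetoid (g≈h x)) (cube n)

  slice : ∀ {n} {A : Set} → Bool → (Vec Bool (suc n) → A) → Vec Bool n → A
  slice b f x = f (b ∷ x)

  agreements-slices : ∀ {n} (f g : Vec Bool (suc n) → Carrier) →
    agreements f g ≡ agreements (slice false f) (slice false g) + agreements (slice true f) (slice true g)
  agreements-slices {n} f g =
    trans (∑-++ 𝟙≈ (map (false ∷_) (cube n)) (map (true ∷_) (cube n)))
          (cong₂ _+_ (∑-map 𝟙≈ (false ∷_) (cube n)) (∑-map 𝟙≈ (true ∷_) (cube n)))
    where
    𝟙≈ : Vec Bool (suc n) → ℕ
    𝟙≈ x = 𝟙[ f x ≟ g x ]

  glue : ∀ {n} → Vec Carrier n → Carrier → Carrier → Poly₁ G (suc n)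
  glue as b c = poly b ((c ∙ b ⁻¹) ∷ as)

  evalP-glue-false : ∀ {n} (as : Vec Carrier n) b c x → evalP G (glue as b c) (false ∷ x) ≈ evalP G (poly b as) x
  evalP-glue-false as b c x = ∙-congˡ (identityˡ (linSum G as x))

  evalP-glue-true : ∀ {n} (as : Vec Carrier n) b c x → evalP G (glue as b c) (true ∷ x) ≈ evalP G (poly c as) x
  evalP-glue-true as b c x = begin
    b ∙ ((c ∙ b ⁻¹) ∙ L)    ≈⟨ assoc b (c ∙ b ⁻¹) L ⟨
    (b ∙ (c ∙ b ⁻¹)) ∙ L    ≈⟨ ∙-congʳ (≈-trans (comm b (c ∙ b ⁻¹)) (//-rightDividesˡ b c)) ⟩
    c ∙ L                   ∎
    where
    open SetoidReasoning setoid
    L = linSum G as x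

  glue-cong : ∀ {n} {as bs : Vec Carrier n} {b b′ c c′} →
    Pointwise _≈_ as bs → b ≈ b′ → c ≈ c′ → glue as b c ≋ glue bs b′ c′
  glue-cong as≈bs b≈b′ c≈c′ = b≈b′ , (∙-cong c≈c′ (⁻¹-cong b≈b′) ∷ as≈bs)

  glue-complete : ∀ {n} a₀ a₁ {as bs : Vec Carrier n} →
    Pointwise _≈_ bs as → glue bs a₀ (a₀ ∙ a₁) ≋ poly a₀ (a₁ ∷ as)
  glue-complete a₀ a₁ bs≈as = ≈-refl , (xyx⁻¹≈y a₀ a₁ ∷ bs≈as)

  elements : List Carrier
  elements = tabulate enum

  elements-complete : IsEnumeration setoid elements
  elements-complete g with enum-surj g
  ... | i , enum-i≈g = ∈-resp-≈ setoid enum-i≈g (∈-tabulate⁺ setoid i)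

  elements-unique : Unique setoid elements
  elements-unique = Uniqueₚ.tabulate⁺ setoid enum-inj

  vectors : ∀ n → List (Vec Carrier n)
  vectors zero    = [] ∷ []
  vectors (suc n) = cartesianProductWith _∷_ elements (vectors n)

  vectors-complete : ∀ n → IsEnumeration (vecSetoid n) (vectors n)
  vectors-complete zero    []       = here []
  vectors-complete (suc n) (a ∷ as) =
    ∈-cartesianProductWith⁺ setoid (vecSetoid n) (vecSetoid (suc n)) _∷_
      (elements-complete a) (vectors-complete n as)

  vectors-unique : ∀ n → Unique (vecSetoid n) (vectors n)
  vectors-unique zero    = [] ∷ []
  vectors-unique (suc n) =
    Uniqueₚ.cartesianProductWith⁺ setoid (vecSetoid n) (vecSetoid (suc n)) _∷_
      Pointwise.uncons elements-unique (vectors-unique n)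

  polys : ∀ n → List (Poly₁ G n)
  polys n = cartesianProductWith (λ as a₀ → poly a₀ as) (vectors n) elements

  polys-unique : ∀ n → Unique (polySetoid n) (polys n)
  polys-unique n =
    Uniqueₚ.cartesianProductWith⁺ (vecSetoid n) setoid (polySetoid n) (λ as a₀ → poly a₀ as)
      (λ (a₀≈b₀ , as≈bs) → as≈bs , a₀≈b₀) (vectors-unique n) elements-unique

  gluings : ∀ n → List (Poly₁ G (suc n))
  gluings n = concatMap (λ as → cartesianProductWith (glue as) elements elements) (vectors n)

  gluings-complete : ∀ n → IsEnumeration (polySetoid (suc n)) (gluings n)
  gluings-complete n (poly a₀ (a₁ ∷ as)) =
    ∈-concatMap⁺ (vecSetoid n) polys⁺ (Any.map glued (vectors-complete n as))
    where
    polys⁺ = polySetoid (suc n)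
    glued : ∀ {bs} → Pointwise _≈_ as bs →
      Membership._∈_ polys⁺ (poly a₀ (a₁ ∷ as)) (cartesianProductWith (glue bs) elements elements)
    glued as≈bs = ∈-resp-≈ polys⁺ (glue-complete a₀ a₁ (Pointwise.sym ≈-sym as≈bs))
      (∈-cartesianProductWith⁺ setoid setoid polys⁺ (glue-cong (Pointwise.refl ≈-refl))
        (elements-complete a₀) (elements-complete (a₀ ∙ a₁)))

  bias : ∀ {n} → (Vec Bool n → Carrier) → Poly₁ G n → ℕ
  bias {n} f P = excess (2 ^ n) (agreements f (evalP G P))

  bias-cong : ∀ {n} (f : Vec Bool n → Carrier) {P Q} → P ≋ Q → bias f P ≡ bias f Q
  bias-cong {n} f P≋Q = cong (excess (2 ^ n)) (agreements-congʳ f (evalP-cong P≋Q))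

  bias-glue : ∀ {n} (f : Vec Bool (suc n) → Carrier) as b c →
    bias f (glue as b c) ≡
    excess (2 * 2 ^ n) (agreements (slice false f) (evalP G (poly b as)) + agreements (slice true f) (evalP G (poly c as)))
  bias-glue {n} f as b c = cong (excess (2 * 2 ^ n)) (trans (agreements-slices f (evalP G (glue as b c)))
    (cong₂ _+_ (agreements-congʳ (slice false f) (evalP-glue-false as b c))
               (agreements-congʳ (slice true f) (evalP-glue-true as b c))))

  translates-unique : ∀ z → Unique setoid (map (_∙ z) elements)
  translates-unique z = Uniqueₚ.map⁺ setoid setoid (∙-cancelʳ z _ _) elements-unique

  ∑-agreements-translates : ∀ {n} (f : Vec Bool n → Carrier) (as : Vec Carrier n) →
    ∑[ b ∈ elements ] agreements f (evalP G (poly b as)) ≤ 2 ^ n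
  ∑-agreements-translates {n} f as = begin
    ∑[ b ∈ elements ] ∑[ x ∈ cube n ] 𝟙[ f x ≟ (b ∙ L x) ]
      ≡⟨ ∑-comm (λ b x → 𝟙[ f x ≟ (b ∙ L x) ]) elements (cube n) ⟩
    ∑[ x ∈ cube n ] ∑[ b ∈ elements ] 𝟙[ f x ≟ (b ∙ L x) ]
      ≡⟨ ∑-cong (λ x → ∑-map (λ y → 𝟙[ f x ≟ y ]) (_∙ L x) elements) (cube n) ⟨
    ∑[ x ∈ cube n ] ∑[ y ∈ map (_∙ L x) elements ] 𝟙[ f x ≟ y ]
      ≤⟨ ∑-mono-≤ (λ x → ∑-𝟙-unique carrierDecSetoid (f x) (translates-unique (L x))) (cube n) ⟩
    ∑[ x ∈ cube n ] 1
      ≡⟨ trans (∑-const-1 (cube n)) (length-cube n) ⟩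
    2 ^ n
      ∎
    where
    open ≤-Reasoning
    L = linSum G as

  gluing-estimate : ∀ {n} (f : Vec Bool (suc n) → Carrier) (as : Vec Carrier n) →
    ∑[ b ∈ elements ] ∑[ c ∈ elements ] bias f (glue as b c) ² ≤
    2 * ∑[ b ∈ elements ] bias (slice false f) (poly b as) ² + 2 * ∑[ c ∈ elements ] bias (slice true f) (poly c as) ²
  gluing-estimate {n} f as = begin
    ∑[ b ∈ elements ] ∑[ c ∈ elements ] bias f (glue as b c) ²
      ≡⟨ ∑-cong (λ b → ∑-cong (λ c → cong _² (bias-glue f as b c)) elements) elements ⟩
    ∑[ b ∈ elements ] ∑[ c ∈ elements ] excess (2 * N) (u b + v c) ²
      ≡⟨ trans (∑-map _ u elements) (∑-cong (λ b → ∑-map _ v elements) elements) ⟨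
    ∑[ x ∈ map u elements ] ∑[ y ∈ map v elements ] excess (2 * N) (x + y) ²
      ≤⟨ ∑∑-excess²≤ (map u elements) (map v elements)
           (∑-agreements-translates (slice false f) as) (∑-agreements-translates (slice true f) as) ⟩
    2 * ∑[ x ∈ map u elements ] excess N x ² + 2 * ∑[ y ∈ map v elements ] excess N y ²
      ≡⟨ cong₂ (λ s t → 2 * s + 2 * t) (∑-map (λ x → excess N x ²) u elements)
                                       (∑-map (λ y → excess N y ²) v elements) ⟩
    2 * ∑[ b ∈ elements ] bias (slice false f) (poly b as) ² + 2 * ∑[ c ∈ elements ] bias (slice true f) (poly c as) ²
      ∎
    where
    open ≤-Reasoning
    N = 2 ^ n
    u v : Carrier → ℕ
    u b = agreements (slice false f) (evalP G (poly b as))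
    v c = agreements (slice true f) (evalP G (poly c as))

  bias²≤𝟙 : (f : Vec Bool 0 → Carrier) (P : Poly₁ G 0) → bias f P ² ≤ 𝟙[ f [] ≟ evalP G P [] ]
  bias²≤𝟙 f P with f [] ≟ evalP G P []
  ... | yes _ = ≤-refl
  ... | no  _ = z≤n

  evalP-injective₀ : ∀ {P Q : Poly₁ G 0} → evalP G P [] ≈ evalP G Q [] → P ≋ Q
  evalP-injective₀ {poly a []} {poly b []} a∙ε≈b∙ε = ∙-cancelʳ ε a b a∙ε≈b∙ε , []

  ∑-bias²≤ : ∀ n (f : Vec Bool n → Carrier) {Ps} → Unique (polySetoid n) Ps →
    ∑[ P ∈ Ps ] bias f P ² ≤ (2 ^ n) ²
  ∑-bias²≤ zero f {Ps} Ps! = begin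
    ∑[ P ∈ Ps ] bias f P ²
      ≤⟨ ∑-mono-≤ (bias²≤𝟙 f) Ps ⟩
    ∑[ P ∈ Ps ] 𝟙[ f [] ≟ evalP G P [] ]
      ≡⟨ ∑-map (λ y → 𝟙[ f [] ≟ y ]) (λ P → evalP G P []) Ps ⟨
    ∑[ y ∈ map (λ P → evalP G P []) Ps ] 𝟙[ f [] ≟ y ]
      ≤⟨ ∑-𝟙-unique carrierDecSetoid (f []) (Uniqueₚ.map⁺ (polySetoid 0) setoid evalP-injective₀ Ps!) ⟩
    1
      ∎
    where open ≤-Reasoning
  ∑-bias²≤ (suc n) f {Ps} Ps! = begin
    ∑[ P ∈ Ps ] bias f P ²
      ≤⟨ ∑-unique≤∑-enumeration (polyDecSetoid (suc n)) (λ P → bias f P ²) (cong _² ∘ bias-cong f)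
                                Ps! (gluings-complete n) ⟩
    ∑[ P ∈ gluings n ] bias f P ²
      ≡⟨ trans (∑-concatMap _ _ (vectors n))
               (∑-cong (λ as → ∑-cartesianProductWith (λ P → bias f P ²) (glue as) elements elements) (vectors n)) ⟩
    ∑[ as ∈ vectors n ] ∑[ b ∈ elements ] ∑[ c ∈ elements ] bias f (glue as b c) ²
      ≤⟨ ∑-mono-≤ (gluing-estimate f) (vectors n) ⟩
    ∑[ as ∈ vectors n ] (2 * slices f₀ as + 2 * slices f₁ as)
      ≡⟨ trans (∑-+ (λ as → 2 * slices f₀ as) (λ as → 2 * slices f₁ as) (vectors n))
               (cong₂ _+_ (∑-*ˡ 2 (slices f₀) (vectors n)) (∑-*ˡ 2 (slices f₁) (vectors n))) ⟩
    2 * ∑[ as ∈ vectors n ] slices f₀ as + 2 * ∑[ as ∈ vectors n ] slices f₁ as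
      ≡⟨ cong₂ (λ s t → 2 * s + 2 * t) (∑-polys f₀) (∑-polys f₁) ⟨
    2 * ∑[ P ∈ polys n ] bias f₀ P ² + 2 * ∑[ P ∈ polys n ] bias f₁ P ²
      ≤⟨ +-mono-≤ (*-monoʳ-≤ 2 (∑-bias²≤ n f₀ (polys-unique n)))
                  (*-monoʳ-≤ 2 (∑-bias²≤ n f₁ (polys-unique n))) ⟩
    2 * (2 ^ n) ² + 2 * (2 ^ n) ²
      ≡⟨ double-square (2 ^ n) ⟩
    (2 ^ suc n) ²
      ∎
    where
    open ≤-Reasoning
    f₀ f₁ : Vec Bool n → Carrier
    f₀ = slice false f
    f₁ = slice true f
    slices : (Vec Bool n → Carrier) → Vec Carrier n → ℕ
    slices g as = ∑[ b ∈ elements ] bias g (poly b as) ²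
    ∑-polys : ∀ g → ∑[ P ∈ polys n ] bias g P ² ≡ ∑[ as ∈ vectors n ] slices g as
    ∑-polys g = ∑-cartesianProductWith (λ P → bias g P ²) (λ as b → poly b as) (vectors n) elements
    double-square : ∀ N → 2 * (N * N) + 2 * (N * N) ≡ (2 * N) * (2 * N)
    double-square = solve-∀

  distinct⇒unique : ∀ {n} {Ps : List (Poly₁ G n)} → AllPairs (λ P Q → ¬ SameFun G P Q) Ps → Unique (polySetoid n) Ps
  distinct⇒unique = AllPairs.map (λ P≠Q P≋Q → P≠Q (evalP-cong P≋Q))

toℚᵘ-/ : ∀ i n .{{_ : NonZero n}} → toℚᵘ (i / n) ℚᵘ.≃ i ℚᵘ./ n
toℚᵘ-/ i (suc n) = ℚ.toℚᵘ-fromℚᵘ (ℚᵘ.mkℚᵘ i n)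

/-+-/ : ∀ i j d .{{_ : NonZero d}} → i ℚᵘ./ d ℚᵘ.+ j ℚᵘ./ d ℚᵘ.≃ (i ℤ.+ j) ℚᵘ./ d
/-+-/ i j (suc k) = *≡* (trans (distrib i j (+ suc k)) (cong ((i ℤ.+ j) ℤ.*_) (sym (ℤ.pos-* (suc k) (suc k)))))
  where
  distrib : ∀ x y z → (x ℤ.* z ℤ.+ y ℤ.* z) ℤ.* z ≡ (x ℤ.+ y) ℤ.* (z ℤ.* z)
  distrib = ℤ-Solver.solve-∀

/≤1 : ∀ {s} d .{{_ : NonZero d}} → s ≤ d → + s ℚᵘ./ d ℚᵘ.≤ ℚᵘ.1ℚᵘ
/≤1 {s} (suc k) s≤d = *≤* (subst₂ ℤ._≤_ (sym (ℤ.*-identityʳ (+ s))) (sym (ℤ.*-identityˡ (+ suc k))) (ℤ.+≤+ s≤d))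

toℚᵘ-sumℚ : ∀ {A : Set} (F : A → ℚ) (a : A → ℕ) d .{{_ : NonZero d}} {xs} →
  All (λ x → toℚᵘ (F x) ℚᵘ.≃ + a x ℚᵘ./ d) xs → toℚᵘ (sumℚ (map F xs)) ℚᵘ.≃ + ∑ xs a ℚᵘ./ d
toℚᵘ-sumℚ F a (suc k) []                   = *≡* refl
toℚᵘ-sumℚ F a d       {x ∷ xs} (Fx≃ ∷ Fxs≃) =
  ℚᵘ.≃-trans (ℚ.toℚᵘ-homo-+ (F x) (sumℚ (map F xs)))
    (ℚᵘ.≃-trans (ℚᵘ.+-cong Fx≃ (toℚᵘ-sumℚ F a d Fxs≃)) (/-+-/ (+ a x) (+ ∑ xs a) d))

-- Denominators are written as suc m, so that NonZero (2 * suc m) and the like are found by reduction.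
½-minus-/ : ∀ {D b m} → 2 * D + b ≡ suc m → toℚᵘ (½ - + D / suc m) ℚᵘ.≃ + b ℚᵘ./ (2 * suc m)
½-minus-/ {D} {b} {m} 2D+b≡N =
  ℚᵘ.≃-trans (ℚ.toℚᵘ-homo-+ ½ (ℚ.- (+ D / N)))
    (ℚᵘ.≃-trans (ℚᵘ.+-congʳ (toℚᵘ ½)
                  (ℚᵘ.≃-trans (ℚ.toℚᵘ-homo‿- (+ D / N)) (ℚᵘ.-‿cong (toℚᵘ-/ (+ D) N))))
      (*≡* (cong (ℤ._* + (2 * N)) numerator)))
  where
  N = suc m
  N≡2D+b : + N ≡ + 2 ℤ.* + D ℤ.+ + b
  N≡2D+b = trans (cong +_ (sym 2D+b≡N)) (trans (ℤ.pos-+ (2 * D) b) (cong (ℤ._+ + b) (ℤ.pos-* 2 D)))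
  cancel : ∀ d p → + 1 ℤ.* (+ 2 ℤ.* d ℤ.+ p) ℤ.+ ℤ.- d ℤ.* + 2 ≡ p
  cancel = ℤ-Solver.solve-∀
  numerator : + 1 ℤ.* + N ℤ.+ ℤ.- + D ℤ.* + 2 ≡ + b
  numerator = trans (cong (λ n → + 1 ℤ.* n ℤ.+ ℤ.- + D ℤ.* + 2) N≡2D+b) (cancel (+ D) (+ b))

toℚᵘ-^2 : ∀ p → toℚᵘ (p ^ℚ 2) ℚᵘ.≃ toℚᵘ p ℚᵘ.* toℚᵘ p
toℚᵘ-^2 p = ℚᵘ.≃-trans (ℚ.toℚᵘ-homo-* p (p ℚ.* 1ℚ))
                       (ℚᵘ.*-congˡ {toℚᵘ p} (ℚᵘ.≃-reflexive (cong toℚᵘ (ℚ.*-identityʳ p))))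

½-minus-/-² : ∀ {D b m} → 2 * D + b ≡ suc m →
  toℚᵘ ((½ - + D / suc m) ^ℚ 2) ℚᵘ.≃ + (b ²) ℚᵘ./ (2 * suc m * (2 * suc m))
½-minus-/-² {D} {b} {m} 2D+b≡N = ℚᵘ.≃-trans (toℚᵘ-^2 (½ - + D / suc m))
  (ℚᵘ.≃-trans (ℚᵘ.*-cong (½-minus-/ {D} {b} {m} 2D+b≡N) (½-minus-/ {D} {b} {m} 2D+b≡N))
    (*≡* (cong (ℤ._* + (2 * suc m * (2 * suc m))) (sym (ℤ.pos-* b b)))))

sumℚ-[½-/]²≤1 : ∀ {A : Set} {N} .{{_ : NonZero N}} (D b : A → ℕ) {xs} → All (λ x → 2 * D x + b x ≡ N) xs →
  ∑[ x ∈ xs ] b x ² ≤ N ² → sumℚ (map (λ x → (½ - + D x / N) ^ℚ 2) xs) ℚ.≤ 1ℚ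
sumℚ-[½-/]²≤1 {N = N@(suc m)} D b {xs} 2D+b≡N Σb²≤N² =
  ℚ.toℚᵘ-cancel-≤ (ℚᵘ.≤-respˡ-≃ (ℚᵘ.≃-sym sum≃) (/≤1 (2 * N * (2 * N)) Σb²≤[2N]²))
  where
  sum≃ = toℚᵘ-sumℚ (λ x → (½ - + D x / N) ^ℚ 2) (λ x → b x ²) (2 * N * (2 * N))
                    (All.map (λ {x} → ½-minus-/-² {D x} {b x} {m}) 2D+b≡N)
  Σb²≤[2N]² : ∑[ x ∈ xs ] b x ² ≤ 2 * N * (2 * N)
  Σb²≤[2N]² = ≤-trans Σb²≤N² (*-mono-≤ (m≤n*m N 2) (m≤n*m N 2))

+suc/1 : ∀ k → + suc k / 1 ≡ 1ℚ ℚ.+ + k / 1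
+suc/1 k = ℚ.toℚᵘ-injective (ℚᵘ.≃-sym (ℚᵘ.≃-trans (ℚ.toℚᵘ-homo-+ 1ℚ (+ k / 1))
  (ℚᵘ.≃-trans (ℚᵘ.+-cong (toℚᵘ-/ (+ 1) 1) (toℚᵘ-/ (+ k) 1))
    (ℚᵘ.≃-trans (/-+-/ (+ 1) (+ k) 1) (ℚᵘ.≃-sym (toℚᵘ-/ (+ suc k) 1))))))

length*≤sumℚ : ∀ {A : Set} (F : A → ℚ) c {xs} → All (λ x → c ℚ.≤ F x) xs →
  (+ length xs / 1) ℚ.* c ℚ.≤ sumℚ (map F xs)
length*≤sumℚ F c {[]}     []            = ℚ.≤-reflexive (ℚ.*-zeroˡ c)
length*≤sumℚ F c {x ∷ xs} (c≤Fx ∷ c≤Fxs) = begin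
  (+ suc (length xs) / 1) ℚ.* c         ≡⟨ cong (ℚ._* c) (+suc/1 (length xs)) ⟩
  (1ℚ ℚ.+ ℓ) ℚ.* c                      ≡⟨ ℚ.*-distribʳ-+ c 1ℚ ℓ ⟩
  1ℚ ℚ.* c ℚ.+ ℓ ℚ.* c                  ≡⟨ cong (ℚ._+ ℓ ℚ.* c) (ℚ.*-identityˡ c) ⟩
  c ℚ.+ ℓ ℚ.* c                         ≤⟨ ℚ.+-mono-≤ c≤Fx (length*≤sumℚ F c c≤Fxs) ⟩
  F x ℚ.+ sumℚ (map F xs)               ∎
  where
  open ℚ.≤-Reasoning
  ℓ = + length xs / 1

^2-mono-≤ : ∀ {p q} → 0ℚ ℚ.≤ p → p ℚ.≤ q → p ^ℚ 2 ℚ.≤ q ^ℚ 2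
^2-mono-≤ {p} {q} 0≤p p≤q = begin
  p ℚ.* (p ℚ.* 1ℚ)   ≡⟨ cong (p ℚ.*_) (ℚ.*-identityʳ p) ⟩
  p ℚ.* p            ≤⟨ ℚ.*-monoʳ-≤-nonNeg p {{ℚ.nonNegative 0≤p}} p≤q ⟩
  q ℚ.* p            ≤⟨ ℚ.*-monoˡ-≤-nonNeg q {{ℚ.nonNegative (ℚ.≤-trans 0≤p p≤q)}} p≤q ⟩
  q ℚ.* q            ≡⟨ cong (q ℚ.*_) (ℚ.*-identityʳ q) ⟨
  q ℚ.* (q ℚ.* 1ℚ)   ∎
  where open ℚ.≤-Reasoning

≤½-ε⇒ : ∀ {δ ε} → 0ℚ ℚ.< ε → δ ℚ.≤ ½ - ε → δ ℚ.≤ ½ × ε ℚ.≤ ½ - δ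
≤½-ε⇒ {δ} {ε} 0<ε δ≤½-ε = ℚ.≤-trans δ≤½-ε ½-ε≤½ , (begin
  ε                      ≡⟨ solve 2 (λ d e → e := d :+ (e :- d)) refl δ ε ⟩
  δ ℚ.+ (ε - δ)          ≤⟨ ℚ.+-monoˡ-≤ (ε - δ) δ≤½-ε ⟩
  (½ - ε) ℚ.+ (ε - δ)    ≡⟨ solve 3 (λ h e d → (h :- e) :+ (e :- d) := h :- d) refl ½ ε δ ⟩
  ½ - δ                  ∎)
  where
  open ℚ.≤-Reasoning
  open ℚ-Solver.+-*-Solver
  ½-ε≤½ : ½ - ε ℚ.≤ ½
  ½-ε≤½ = ℚ.≤-trans (ℚ.+-monoʳ-≤ ½ (ℚ.neg-antimono-≤ (ℚ.<⇒≤ 0<ε))) (ℚ.≤-reflexive (ℚ.+-identityʳ ½))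

*ε²≤1⇒≤[1/ε]² : ∀ ℓ ε .{{_ : ℚ.Positive ε}} →
  ℓ ℚ.* ε ^ℚ 2 ℚ.≤ 1ℚ → ℓ ℚ.≤ (1/ ε) {{ℚ.pos⇒nonZero ε}} ^ℚ 2
*ε²≤1⇒≤[1/ε]² ℓ ε ℓε²≤1 = begin
  ℓ                                  ≡⟨ ℓε²t²≡ℓ ⟨
  (ℓ ℚ.* ε ^ℚ 2) ℚ.* t ^ℚ 2          ≤⟨ ℚ.*-monoʳ-≤-nonNeg (t ^ℚ 2) {{t²≥0}} ℓε²≤1 ⟩
  1ℚ ℚ.* t ^ℚ 2                      ≡⟨ ℚ.*-identityˡ (t ^ℚ 2) ⟩
  t ^ℚ 2                             ∎
  where
  open ℚ.≤-Reasoning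
  open ℚ-Solver.+-*-Solver
  instance
    ε≢0 : ℚ.NonZero ε
    ε≢0 = ℚ.pos⇒nonZero ε
  t = 1/ ε
  ℓε²t²≡ℓ : (ℓ ℚ.* ε ^ℚ 2) ℚ.* t ^ℚ 2 ≡ ℓ
  ℓε²t²≡ℓ = ≡.begin
    (ℓ ℚ.* ε ^ℚ 2) ℚ.* t ^ℚ 2          ≡.≡⟨ solve 3 (λ l e t → (l :* (e :* (e :* con 1ℚ))) :* (t :* (t :* con 1ℚ))
                                                      := l :* ((e :* t) :* (e :* t))) refl ℓ ε t ⟩
    ℓ ℚ.* ((ε ℚ.* t) ℚ.* (ε ℚ.* t))    ≡.≡⟨ cong (λ x → ℓ ℚ.* (x ℚ.* x)) (ℚ.*-inverseʳ ε) ⟩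
    ℓ ℚ.* (1ℚ ℚ.* 1ℚ)                  ≡.≡⟨ ℚ.*-identityʳ ℓ ⟩
    ℓ                                  ≡.∎
    where module ≡ = ≡-Reasoning
  t²≥0 : ℚ.NonNegative (t ^ℚ 2)
  t²≥0 = ℚ.nonNegative (^2-mono-≤ ℚ.≤-refl (ℚ.<⇒≤ (ℚ.positive⁻¹ (1/ ε) {{ℚ.1/pos⇒pos ε}})))

/≤½⇒2*≤ : ∀ {D N} .{{_ : NonZero N}} → + D / N ℚ.≤ ½ → 2 * D ≤ N
/≤½⇒2*≤ {D} {N@(suc _)} D/N≤½ = subst (_≤ N) (*-comm D 2) (ℤ.drop‿+≤+ 2D≤N)
  where
  cross : + D ℤ.* + 2 ℤ.≤ + 1 ℤ.* + N
  cross = ℚᵘ.drop-*≤* (ℚᵘ.≤-respˡ-≃ (toℚᵘ-/ (+ D) N) (ℚ.toℚᵘ-mono-≤ D/N≤½))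
  2D≤N : + (D * 2) ℤ.≤ + N
  2D≤N = subst₂ ℤ._≤_ (sym (ℤ.pos-* D 2)) (ℤ.*-identityˡ (+ N)) cross

module _ (G : FiniteAbelianGroup) where

  open FiniteAbelianGroup G using (Carrier)

  sumℚ-α²≤1 : ∀ {n} (f : Vec Bool n → Carrier) (Ps : List (Poly₁ G n)) →
    AllPairs (λ P Q → ¬ SameFun G P Q) Ps → All (λ P → δ G f (evalP G P) ℚ.≤ ½) Ps →
    sumℚ (map (λ P → (½ - δ G f (evalP G P)) ^ℚ 2) Ps) ℚ.≤ 1ℚ
  sumℚ-α²≤1 {n} f Ps distinct close =
    sumℚ-[½-/]²≤1 {N = 2 ^ n} {{m^n≢0 2 n}} dis (bias G f) (All.map (λ {P} → complement {P}) close)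
                  (∑-bias²≤ G n f (distinct⇒unique G distinct))
    where
    dis : Poly₁ G n → ℕ
    dis P = disagree G f (evalP G P)
    complement : ∀ {P} → δ G f (evalP G P) ℚ.≤ ½ → 2 * dis P + bias G f P ≡ 2 ^ n
    complement {P} δ≤½ = excess-complement {dis P} {agreements G f (evalP G P)}
                           (disagree+agreements G f (evalP G P)) (/≤½⇒2*≤ {D = dis P} {{m^n≢0 2 n}} δ≤½)

  length≤[1/ε]² : ∀ {n} (f : Vec Bool n → Carrier) (ε : ℚ) (ε>0 : 0ℚ ℚ.< ε) (Ps : List (Poly₁ G n)) →
    AllPairs (λ P Q → ¬ SameFun G P Q) Ps → All (λ P → δ G f (evalP G P) ℚ.≤ ½ - ε) Ps →
    (+ length Ps / 1) ℚ.≤ ((1/ ε) {{pos⇒nonZero ε {{positive ε>0}}}}) ^ℚ 2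
  length≤[1/ε]² f ε ε>0 Ps distinct close =
    *ε²≤1⇒≤[1/ε]² (+ length Ps / 1) ε {{positive ε>0}}
      (ℚ.≤-trans ℓε²≤∑α² (sumℚ-α²≤1 f Ps distinct (All.map (proj₁ ∘ ≤½-ε⇒ ε>0) close)))
    where
    ℓε²≤∑α² = length*≤sumℚ (λ P → (½ - δ G f (evalP G P)) ^ℚ 2) (ε ^ℚ 2)
                (All.map (λ δ≤ → ^2-mono-≤ (ℚ.<⇒≤ ε>0) (proj₂ (≤½-ε⇒ ε>0 δ≤))) close)

lemma4p19 : ∃ λ (D : ℕ) → (1 ≤ D) ×
    (∀ (q : ℕ) → (q ≡ 2 ⊎ q ≡ 3) →
     ∀ (G : FiniteAbelianGroup) → IsQGroup q G →
     ∀ (n : ℕ) (f : Vec Bool n → ∣ G ∣) →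
       (∀ (Ps : List (Poly₁ G n)) →
          AllPairs (λ P Q → ¬ SameFun G P Q) Ps →
          All (λ P → δ G f (evalP G P) ℚ.≤ ½) Ps →
          sumℚ (map (λ P → (½ - δ G f (evalP G P)) ^ℚ D) Ps) ℚ.≤ 1ℚ)
       ×
       (∀ (ε : ℚ) (ε>0 : 0ℚ ℚ.< ε) (Ps : List (Poly₁ G n)) →
          AllPairs (λ P Q → ¬ SameFun G P Q) Ps →
          All (λ P → δ G f (evalP G P) ℚ.≤ ½ - ε) Ps →
          (+ length Ps / 1) ℚ.≤ ((1/ ε) {{pos⇒nonZero ε {{positive ε>0}}}}) ^ℚ D))
lemma4p19 = 2 , s≤s z≤n , λ _ _ G _ n f → sumℚ-α²≤1 G f , length≤[1/ε]² G f
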